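{- Let $\mathcal{P}$ be a system of polynomial equations. If every semantic Sherali-Adams refutation of $\mathcal{P}$ has coefficient size at least $s$, then every unary Sherali-Adams refutation of $\mathcal{P}$ has size at least $s$.
   Context: Semantic Sherali-Adams: let $\mathcal{P}=\{p_1=0,\dots,p_m=0\}$ be a system of polynomial equations over variables $x_1,\dots,x_n$ and twin variables $\bar x_1,\dots,\bar x_n$, and let $I_{B_n}$ be the ideal generated by $x_i(1-x_i)$, $\bar x_i(1-\bar x_i)$ and $1-\bar x_i-x_i$ for $i\in[n]$. A refutation of $\mathcal{P}$ is a sequence of polynomials $(g_1,\dots,g_m,f_0)$ where $f_0=\sum_{A,B\subseteq[n]}\alpha_{A,B}\prod_{i\in A}x_i\prod_{i\in B}\bar x_i$ with all $\alpha_{A,B}\ge0$, such that $\sum_j g_jp_j+f_0\equiv-1\pmod{I_{B_n}}$. With all polynomials on the left-hand side expanded as sums of monomials without cancellations, the size is the sum of the sizes of the binary encodings of the nonzero coefficients and the coefficient size is the sum of their absolute values. A unary Sherali-Adams refutation is defined in the same way except that every such coefficient is $+1$ or $-1$, $f_0$ is a non-negative sum of monomials, and the right-hand side $-1$ is replaced by $-M$ for some positive integer $M$, i.e. $\sum_j g_jp_j+f_0\equiv -M\pmod{I_{B_n}}$. -}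

module Defs where

open import Data.Nat as ℕ using (ℕ; zero; suc)
open import Data.Nat.Logarithm using (⌊log₂_⌋)
open import Data.Nat.ListAction using () renaming (sum to sumℕ)
open import Data.Integer as ℤ using (ℤ; +_)
open import Data.Rational as ℚ using (ℚ; 0ℚ; 1ℚ; ↥_; ↧ₙ_)
import Data.Rational.Properties as ℚP
open import Data.Fin using (Fin)
open import Data.Vec as Vec using (Vec; []; _∷_)
import Data.Vec.Properties as VecP
open import Data.List as List using (List; []; _∷_; _++_)
open import Data.List.Relation.Unary.All using (All)
import Data.Vec.Relation.Unary.All as VAll
open import Data.Product using (_×_; _,_; proj₁; proj₂; ∃)
import Data.Product.Properties as ProdP
open import Data.Sum using (_⊎_)
open import Relation.Nullary using (¬_; ¬?; does)
open import Relation.Binary.PropositionalEquality using (_≡_)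
open import Relation.Binary.Definitions using (DecidableEquality)

-- Monomials over x₁..xₙ and twin variables x̄₁..x̄ₙ:
-- a pair of exponent vectors (exponents of the xᵢ, exponents of the x̄ᵢ).

Mono : ℕ → Set
Mono n = Vec ℕ n × Vec ℕ n

_≟M_ : ∀ {n} → DecidableEquality (Mono n)
_≟M_ = ProdP.≡-dec (VecP.≡-dec ℕ._≟_) (VecP.≡-dec ℕ._≟_)

oneM : ∀ {n} → Mono n
oneM = Vec.replicate _ 0 , Vec.replicate _ 0

_*M_ : ∀ {n} → Mono n → Mono n → Mono n
(a , b) *M (c , d) = Vec.zipWith ℕ._+_ a c , Vec.zipWith ℕ._+_ b d

xM x̄M : ∀ {n} → Fin n → Mono n
xM i = Vec.updateAt (Vec.replicate _ 0) i (λ _ → 1) , Vec.replicate _ 0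
x̄M i = Vec.replicate _ 0 , Vec.updateAt (Vec.replicate _ 0) i (λ _ → 1)

Multilinear : ∀ {n} → Mono n → Set
Multilinear (a , b) = VAll.All (ℕ._≤ 1) a × VAll.All (ℕ._≤ 1) b

-- Polynomials with rational coefficients, as formal sums of terms
-- (coefficient, monomial).  Two formal sums denote the same polynomial
-- iff they have the same coefficient at every monomial (see _≈P_).

Poly : ℕ → Set
Poly n = List (ℚ × Mono n)

sumℚ : List ℚ → ℚ
sumℚ = List.foldr ℚ._+_ 0ℚ

coeff : ∀ {n} → Poly n → Mono n → ℚ
coeff p m = sumℚ (List.map proj₁ (List.filter (λ t → proj₂ t ≟M m) p))

_≈P_ : ∀ {n} → Poly n → Poly n → Set
p ≈P q = ∀ m → coeff p m ≡ coeff q m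

constP : ∀ {n} → ℚ → Poly n
constP c = (c , oneM) ∷ []

_+P_ : ∀ {n} → Poly n → Poly n → Poly n
_+P_ = _++_

-P_ : ∀ {n} → Poly n → Poly n
-P_ = List.map (λ t → ℚ.- proj₁ t , proj₂ t)

_-P_ : ∀ {n} → Poly n → Poly n → Poly n
p -P q = p +P (-P q)

_*P_ : ∀ {n} → Poly n → Poly n → Poly n
p *P q = List.concatMap (λ t → List.map (λ u → proj₁ t ℚ.* proj₁ u , proj₂ t *M proj₂ u) q) p

sumP : ∀ {n} → List (Poly n) → Poly n
sumP = List.foldr _+P_ []

xP x̄P : ∀ {n} → Fin n → Poly n
xP i = (1ℚ , xM i) ∷ []
x̄P i = (1ℚ , x̄M i) ∷ []

genI : ∀ {n} → Fin n → Poly n × Poly n × Poly n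
genI i = xP i *P (constP 1ℚ -P xP i)
       , x̄P i *P (constP 1ℚ -P x̄P i)
       , (constP 1ℚ -P x̄P i) -P xP i

InIdealB : ∀ {n} → Poly n → Set
InIdealB {n} p = ∃ λ (h : Vec (Poly n × Poly n × Poly n) n) →
  p ≈P sumP (Vec.toList (Vec.zipWith
      (λ hi gi → (proj₁ hi *P proj₁ gi) +P ((proj₁ (proj₂ hi) *P proj₁ (proj₂ gi))
                 +P (proj₂ (proj₂ hi) *P proj₂ (proj₂ gi))))
      h (Vec.tabulate genI)))

_≡P_modIB : ∀ {n} → Poly n → Poly n → Set
p ≡P q modIB = InIdealB (p -P q)

support : ∀ {n} → Poly n → List (Mono n)
support p = List.filter (λ m → ¬? (coeff p m ℚP.≟ 0ℚ))
                        (List.deduplicate _≟M_ (List.map proj₂ p))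

bitsℕ : ℕ → ℕ
bitsℕ k = suc ⌊log₂ k ⌋

-- binary encoding size of a rational: sign bit + numerator + denominator
bitsizeℚ : ℚ → ℕ
bitsizeℚ q = suc (bitsℕ ℤ.∣ ↥ q ∣ ℕ.+ bitsℕ (↧ₙ q))

sizeP : ∀ {n} → Poly n → ℕ
sizeP p = sumℕ (List.map (λ m → bitsizeℚ (coeff p m)) (support p))

coeffSizeP : ∀ {n} → Poly n → ℚ
coeffSizeP p = sumℚ (List.map (λ m → ℚ.∣ coeff p m ∣) (support p))

SAConeTerm : ∀ {n} → ℚ × Mono n → Set
SAConeTerm (c , mono) = 0ℚ ℚ.≤ c × Multilinear mono

record SemanticSARefutation {n m : ℕ} (P : Vec (Poly n) m) : Set where
  field
    g     : Vec (Poly n) m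
    f₀    : Poly n
    f₀-ok : All SAConeTerm f₀
    eqn   : (sumP (Vec.toList (Vec.zipWith _*P_ g P)) +P f₀) ≡P constP (ℚ.- 1ℚ) modIB

  -- the summands on the left-hand side, each expanded separately
  summands : List (Poly n)
  summands = Vec.toList (Vec.zipWith _*P_ g P) List.∷ʳ f₀

  size : ℕ
  size = sumℕ (List.map sizeP summands)

  coeffSize : ℚ
  coeffSize = sumℚ (List.map coeffSizeP summands)

PlusMinusOne : ℚ → Set
PlusMinusOne c = c ≡ 1ℚ ⊎ c ≡ ℚ.- 1ℚ

record UnarySARefutation {n m : ℕ} (P : Vec (Poly n) m) : Set where
  field
    g     : Vec (Poly n) m
    f₀    : Poly n
    f₀-ok : All SAConeTerm f₀
    M     : ℕ
    M-pos : 1 ℕ.≤ M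
    eqn   : (sumP (Vec.toList (Vec.zipWith _*P_ g P)) +P f₀) ≡P constP (ℚ.- ((+ M) ℚ./ 1)) modIB

  summands : List (Poly n)
  summands = Vec.toList (Vec.zipWith _*P_ g P) List.∷ʳ f₀

  field
    unit-coeffs : All (λ q → All (λ mono → PlusMinusOne (coeff q mono)) (support q)) summands
    f₀-unit     : All (λ mono → coeff f₀ mono ≡ 1ℚ) (support f₀)

  size : ℕ
  size = sumℕ (List.map sizeP summands)

{-# OPTIONS --safe #-}
-- Dividing a unary refutation (right-hand side −M) by M yields a semantic
-- refutation, because congruence modulo I_{B_n} and the Sherali-Adams cone are
-- preserved by nonnegative scaling.  Its coefficient size is 1/M ≤ 1 times the
-- sum of the absolute values of the unary coefficients; these are all ±1, and
-- each one costs at least one bit in the size of the unary refutation.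
module Submission where

open import Defs
open import Data.Nat using (ℕ)
open import Data.Integer using (+_)
open import Data.Rational using (ℚ; _≤_; _/_)
open import Data.Vec using (Vec)

open import Function using (_∘_)
open import Data.Nat as ℕ using (suc; z≤n; s≤s)
open import Data.Nat.Coprimality using (1-coprimeTo) renaming (sym to coprime-sym)
open import Data.Nat.ListAction using () renaming (sum to sumℕ)
open import Data.Integer as ℤ using (+≤+)
import Data.Integer.Properties as ℤP
open import Data.Rational
  using (mkℚ; 0ℚ; 1ℚ; _+_; _*_; -_; ∣_∣; 1/_; *≤*; nonNegative; NonNegative)
open import Data.Rational.Properties
  using ( normalize-coprime; normalize-nonNeg; /-cong; _≟_; ≤-refl; ≤-reflexive; ≤-trans
        ; +-mono-≤; +-identityˡ; *-zeroʳ; *-identityˡ; *-assoc; *-distribˡ-+; *-inverseˡ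
        ; neg-distribʳ-*; ∣p*q∣≡∣p∣*∣q∣; 0≤p⇒∣p∣≡p
        ; *-monoˡ-≤-nonNeg; *-monoʳ-≤-nonNeg; module ≤-Reasoning )
open import Data.List as List using (List; []; _∷_; _++_; _∷ʳ_)
import Data.List.Properties as List
open import Data.List.Relation.Unary.All using (All; []; _∷_)
import Data.List.Relation.Unary.All as All
import Data.List.Relation.Unary.All.Properties as All
import Data.Vec as Vec
open import Data.Product using (_×_; _,_; proj₁; proj₂; map₁; ∃)
open import Data.Sum using (inj₁; inj₂)
open import Relation.Nullary using (yes; no; ¬?)
open import Relation.Binary.PropositionalEquality

fromℕ : ℕ → ℚ
fromℕ n = + n / 1

-- _/_ normalises through gcd, which is stuck on variables; the normal form computes.
fromℕ≡mkℚ : ∀ n → fromℕ n ≡ mkℚ (+ n) 0 (coprime-sym (1-coprimeTo n))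
fromℕ≡mkℚ n = normalize-coprime (coprime-sym (1-coprimeTo n))

fromℕ-+ : ∀ a b → fromℕ (a ℕ.+ b) ≡ fromℕ a + fromℕ b
fromℕ-+ a b = trans
  (/-cong {p₁ = + (a ℕ.+ b)} {p₂ = + a ℤ.* + 1 ℤ.+ + b ℤ.* + 1}
     (cong₂ ℤ._+_ (sym (ℤP.*-identityʳ (+ a))) (sym (ℤP.*-identityʳ (+ b)))) refl)
  (cong₂ _+_ (sym (fromℕ≡mkℚ a)) (sym (fromℕ≡mkℚ b)))

fromℕ-nonNeg : ∀ n → NonNegative (fromℕ n)
fromℕ-nonNeg n = normalize-nonNeg n 1

reciprocal≤1 : ∀ M → 1 ℕ.≤ M → ∃ λ c → 0ℚ ≤ c × c ≤ 1ℚ × c * fromℕ M ≡ 1ℚ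
reciprocal≤1 (suc k) _ =
  1/ M , *≤* (+≤+ z≤n) , *≤* (+≤+ (s≤s z≤n)) ,
  trans (cong (1/ M *_) (fromℕ≡mkℚ (suc k))) (*-inverseˡ M)
  where
  M : ℚ
  M = mkℚ (+ suc k) 0 (coprime-sym (1-coprimeTo (suc k)))

module _ {A : Set} where

  sumℚ-map-*ˡ : ∀ c (f : A → ℚ) xs → sumℚ (List.map (λ x → c * f x) xs) ≡ c * sumℚ (List.map f xs)
  sumℚ-map-*ˡ c f []       = sym (*-zeroʳ c)
  sumℚ-map-*ˡ c f (x ∷ xs) =
    trans (cong (_+_ (c * f x)) (sumℚ-map-*ˡ c f xs)) (sym (*-distribˡ-+ c (f x) _))

  sumℚ-map-≤-fromℕ-sumℕ : ∀ (f : A → ℚ) (b : A → ℕ) {xs} → All (λ x → f x ≤ fromℕ (b x)) xs →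
                           sumℚ (List.map f xs) ≤ fromℕ (sumℕ (List.map b xs))
  sumℚ-map-≤-fromℕ-sumℕ f b []                        = ≤-refl
  sumℚ-map-≤-fromℕ-sumℕ f b {x ∷ xs} (fx≤bx ∷ fxs≤bxs) =
    ≤-trans (+-mono-≤ fx≤bx (sumℚ-map-≤-fromℕ-sumℕ f b fxs≤bxs))
            (≤-reflexive (sym (fromℕ-+ (b x) (sumℕ (List.map b xs)))))

  sumℚ-∣∣-filter-nonzero : ∀ (f : A → ℚ) xs →
    sumℚ (List.map (∣_∣ ∘ f) (List.filter (λ x → ¬? (f x ≟ 0ℚ)) xs)) ≡ sumℚ (List.map (∣_∣ ∘ f) xs)
  sumℚ-∣∣-filter-nonzero f [] = refl
  sumℚ-∣∣-filter-nonzero f (x ∷ xs) with f x ≟ 0ℚ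
  ... | yes fx≡0 = trans (sumℚ-∣∣-filter-nonzero f xs) (sym (begin
      ∣ f x ∣ + rest ≡⟨ cong (λ a → ∣ a ∣ + rest) fx≡0 ⟩
      0ℚ + rest      ≡⟨ +-identityˡ rest ⟩
      rest           ∎))
    where
    open ≡-Reasoning
    rest : ℚ
    rest = sumℚ (List.map (∣_∣ ∘ f) xs)
  ... | no  _    = cong (_+_ ∣ f x ∣) (sumℚ-∣∣-filter-nonzero f xs)

toList-zipWith-map : ∀ {X Y Z : Set} {k} (F : X → Y → Z) (φ : X → X) (ψ : Z → Z) →
  (∀ x y → F (φ x) y ≡ ψ (F x y)) → (xs : Vec X k) (ys : Vec Y k) →
  Vec.toList (Vec.zipWith F (Vec.map φ xs) ys) ≡ List.map ψ (Vec.toList (Vec.zipWith F xs ys))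
toList-zipWith-map F φ ψ hom Vec.[]       Vec.[]       = refl
toList-zipWith-map F φ ψ hom (x Vec.∷ xs) (y Vec.∷ ys) =
  cong₂ _∷_ (hom x y) (toList-zipWith-map F φ ψ hom xs ys)

∣±1∣≤bitsizeℚ : ∀ {c} → PlusMinusOne c → ∣ c ∣ ≤ fromℕ (bitsizeℚ c)
∣±1∣≤bitsizeℚ (inj₁ refl) = *≤* (+≤+ (s≤s z≤n))
∣±1∣≤bitsizeℚ (inj₂ refl) = *≤* (+≤+ (s≤s z≤n))

module _ {n : ℕ} where

  scaleP : ℚ → Poly n → Poly n
  scaleP c = List.map (map₁ (c *_))

  coeff-map₁ : (f : ℚ → ℚ) → f 0ℚ ≡ 0ℚ → (∀ a b → f (a + b) ≡ f a + f b) →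
               ∀ (p : Poly n) mono → coeff (List.map (map₁ f) p) mono ≡ f (coeff p mono)
  coeff-map₁ f f0≡0 f-+ []                mono = sym f0≡0
  coeff-map₁ f f0≡0 f-+ ((a , mono′) ∷ p) mono with mono′ ≟M mono
  ... | yes _ = trans (cong (_+_ (f a)) (coeff-map₁ f f0≡0 f-+ p mono)) (sym (f-+ a _))
  ... | no  _ = coeff-map₁ f f0≡0 f-+ p mono

  coeff-scaleP : ∀ c (p : Poly n) mono → coeff (scaleP c p) mono ≡ c * coeff p mono
  coeff-scaleP c = coeff-map₁ (c *_) (*-zeroʳ c) (*-distribˡ-+ c)

  ≈P-scaleP : ∀ c {p q : Poly n} → p ≈P q → scaleP c p ≈P scaleP c q
  ≈P-scaleP c {p} {q} p≈q mono = begin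
    coeff (scaleP c p) mono ≡⟨ coeff-scaleP c p mono ⟩
    c * coeff p mono        ≡⟨ cong (c *_) (p≈q mono) ⟩
    c * coeff q mono        ≡⟨ coeff-scaleP c q mono ⟨
    coeff (scaleP c q) mono ∎
    where open ≡-Reasoning

  scaleP-++ : ∀ c (p q : Poly n) → scaleP c (p +P q) ≡ scaleP c p +P scaleP c q
  scaleP-++ c = List.map-++ (map₁ (c *_))

  scaleP-negP : ∀ c (p : Poly n) → scaleP c (-P p) ≡ -P scaleP c p
  scaleP-negP c []               = refl
  scaleP-negP c ((a , mono) ∷ p) =
    cong₂ _∷_ (cong (_, mono) (sym (neg-distribʳ-* c a))) (scaleP-negP c p)

  scaleP-*P : ∀ c (p q : Poly n) → scaleP c p *P q ≡ scaleP c (p *P q)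
  scaleP-*P c []               q = refl
  scaleP-*P c ((a , mono) ∷ p) q = begin
      List.map (λ u → c * a * proj₁ u , mono *M proj₂ u) q ++ (scaleP c p *P q)
    ≡⟨ cong₂ _++_ (List.map-cong (λ u → cong (_, mono *M proj₂ u) (*-assoc c a (proj₁ u))) q)
                  (scaleP-*P c p q) ⟩
      List.map (map₁ (c *_) ∘ aq) q ++ scaleP c (p *P q)
    ≡⟨ cong (_++ scaleP c (p *P q)) (List.map-∘ q) ⟩
      scaleP c (List.map aq q) ++ scaleP c (p *P q)
    ≡⟨ scaleP-++ c (List.map aq q) (p *P q) ⟨
      scaleP c (((a , mono) ∷ p) *P q) ∎
    where
    open ≡-Reasoning
    aq : ℚ × Mono n → ℚ × Mono n
    aq u = a * proj₁ u , mono *M proj₂ u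

  scaleP-sumP : ∀ c (ps : List (Poly n)) → scaleP c (sumP ps) ≡ sumP (List.map (scaleP c) ps)
  scaleP-sumP c []       = refl
  scaleP-sumP c (p ∷ ps) =
    trans (scaleP-++ c p (sumP ps)) (cong (scaleP c p ++_) (scaleP-sumP c ps))

  sumP-zipWith-map : ∀ {X Y : Set} {k} c (F : X → Y → Poly n) (φ : X → X) →
    (∀ x y → F (φ x) y ≡ scaleP c (F x y)) → (xs : Vec X k) (ys : Vec Y k) →
    sumP (Vec.toList (Vec.zipWith F (Vec.map φ xs) ys))
      ≡ scaleP c (sumP (Vec.toList (Vec.zipWith F xs ys)))
  sumP-zipWith-map c F φ hom xs ys =
    trans (cong sumP (toList-zipWith-map F φ (scaleP c) hom xs ys))
          (sym (scaleP-sumP c (Vec.toList (Vec.zipWith F xs ys))))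

  Poly³ : Set
  Poly³ = Poly n × Poly n × Poly n

  -- Definitionally the summand of InIdealB, with h the multipliers and g the generators.
  combine : Poly³ → Poly³ → Poly n
  combine (h₁ , h₂ , h₃) (g₁ , g₂ , g₃) = (h₁ *P g₁) +P ((h₂ *P g₂) +P (h₃ *P g₃))

  scaleP³ : ℚ → Poly³ → Poly³
  scaleP³ c (h₁ , h₂ , h₃) = scaleP c h₁ , scaleP c h₂ , scaleP c h₃

  combine-scaleP³ : ∀ c h g → combine (scaleP³ c h) g ≡ scaleP c (combine h g)
  combine-scaleP³ c (h₁ , h₂ , h₃) (g₁ , g₂ , g₃) = begin
      (scaleP c h₁ *P g₁) +P ((scaleP c h₂ *P g₂) +P (scaleP c h₃ *P g₃))
    ≡⟨ cong₂ _+P_ (scaleP-*P c h₁ g₁) (cong₂ _+P_ (scaleP-*P c h₂ g₂) (scaleP-*P c h₃ g₃)) ⟩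
      scaleP c (h₁ *P g₁) +P (scaleP c (h₂ *P g₂) +P scaleP c (h₃ *P g₃))
    ≡⟨ cong (scaleP c (h₁ *P g₁) +P_) (scaleP-++ c (h₂ *P g₂) (h₃ *P g₃)) ⟨
      scaleP c (h₁ *P g₁) +P scaleP c ((h₂ *P g₂) +P (h₃ *P g₃))
    ≡⟨ scaleP-++ c (h₁ *P g₁) _ ⟨
      scaleP c (combine (h₁ , h₂ , h₃) (g₁ , g₂ , g₃)) ∎
    where open ≡-Reasoning

  InIdealB-scaleP : ∀ c {p : Poly n} → InIdealB p → InIdealB (scaleP c p)
  InIdealB-scaleP c {p} (h , p≈ideal) =
    Vec.map (scaleP³ c) h ,
    subst (scaleP c p ≈P_) (sym (sumP-zipWith-map c combine (scaleP³ c) (combine-scaleP³ c) h gens))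
          (≈P-scaleP c {p} {sumP (Vec.toList (Vec.zipWith combine h gens))} p≈ideal)
    where
    gens : Vec Poly³ n
    gens = Vec.tabulate genI

  modIB-scaleP : ∀ c {p q : Poly n} → p ≡P q modIB → scaleP c p ≡P scaleP c q modIB
  modIB-scaleP c {p} {q} p≡q =
    subst InIdealB (trans (scaleP-++ c p (-P q)) (cong (scaleP c p +P_) (scaleP-negP c q)))
          (InIdealB-scaleP c {p -P q} p≡q)

  SAConeTerm-scaleP : ∀ {c} → 0ℚ ≤ c → {f : Poly n} → All SAConeTerm f → All SAConeTerm (scaleP c f)
  SAConeTerm-scaleP {c} 0≤c = All.map⁺ ∘ All.map λ (0≤a , multilinear) →
    ≤-trans (≤-reflexive (sym (*-zeroʳ c))) (*-monoˡ-≤-nonNeg c {{nonNegative 0≤c}} 0≤a) ,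
    multilinear

  monomials : Poly n → List (Mono n)
  monomials p = List.deduplicate {R = _≡_} _≟M_ (List.map proj₂ p)

  monomials-scaleP : ∀ c (p : Poly n) → monomials (scaleP c p) ≡ monomials p
  monomials-scaleP c p = cong (List.deduplicate {R = _≡_} _≟M_) (sym (List.map-∘ p))

  -- Unlike the support, the monomials of p are not changed by scaling.
  coeffSizeP≡sum-∣coeff∣ : ∀ (p : Poly n) →
                           coeffSizeP p ≡ sumℚ (List.map (∣_∣ ∘ coeff p) (monomials p))
  coeffSizeP≡sum-∣coeff∣ p = sumℚ-∣∣-filter-nonzero (coeff p) (monomials p)

  coeffSizeP-scaleP : ∀ c (p : Poly n) → coeffSizeP (scaleP c p) ≡ ∣ c ∣ * coeffSizeP p
  coeffSizeP-scaleP c p = begin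
      coeffSizeP (scaleP c p)
    ≡⟨ coeffSizeP≡sum-∣coeff∣ (scaleP c p) ⟩
      sumℚ (List.map (∣_∣ ∘ coeff (scaleP c p)) (monomials (scaleP c p)))
    ≡⟨ cong (sumℚ ∘ List.map (∣_∣ ∘ coeff (scaleP c p))) (monomials-scaleP c p) ⟩
      sumℚ (List.map (∣_∣ ∘ coeff (scaleP c p)) (monomials p))
    ≡⟨ cong sumℚ (List.map-cong (λ mono → trans (cong ∣_∣ (coeff-scaleP c p mono))
                                                 (∣p*q∣≡∣p∣*∣q∣ c (coeff p mono)))
                                (monomials p)) ⟩
      sumℚ (List.map (λ mono → ∣ c ∣ * ∣ coeff p mono ∣) (monomials p))
    ≡⟨ sumℚ-map-*ˡ ∣ c ∣ (∣_∣ ∘ coeff p) (monomials p) ⟩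
      ∣ c ∣ * sumℚ (List.map (∣_∣ ∘ coeff p) (monomials p))
    ≡⟨ cong (∣ c ∣ *_) (coeffSizeP≡sum-∣coeff∣ p) ⟨
      ∣ c ∣ * coeffSizeP p ∎
    where open ≡-Reasoning

  coeffSizeP≤sizeP : ∀ {p : Poly n} → All (λ mono → PlusMinusOne (coeff p mono)) (support p) →
                     coeffSizeP p ≤ fromℕ (sizeP p)
  coeffSizeP≤sizeP {p} =
    sumℚ-map-≤-fromℕ-sumℕ (∣_∣ ∘ coeff p) (bitsizeℚ ∘ coeff p) ∘ All.map ∣±1∣≤bitsizeℚ

module _ {n m : ℕ} {P : Vec (Poly n) m} where

  unaryCoeffSize : UnarySARefutation P → ℚ
  unaryCoeffSize π = sumℚ (List.map coeffSizeP (UnarySARefutation.summands π))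

  unaryCoeffSize≤size : (π : UnarySARefutation P) →
                        unaryCoeffSize π ≤ fromℕ (UnarySARefutation.size π)
  unaryCoeffSize≤size π = sumℚ-map-≤-fromℕ-sumℕ coeffSizeP sizeP
    (All.map (λ {q} → coeffSizeP≤sizeP {p = q}) (UnarySARefutation.unit-coeffs π))

  module DivideUnary (π : UnarySARefutation P) {c : ℚ} (0≤c : 0ℚ ≤ c)
                     (c*M≡1 : c * fromℕ (UnarySARefutation.M π) ≡ 1ℚ) where

    open UnarySARefutation π

    products : List (Poly n)
    products = Vec.toList (Vec.zipWith _*P_ g P)

    scaled-g : Vec (Poly n) m
    scaled-g = Vec.map (scaleP c) g

    scaled-eqn : (sumP (Vec.toList (Vec.zipWith _*P_ scaled-g P)) +P scaleP c f₀)
                   ≡P constP (- 1ℚ) modIB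
    scaled-eqn = subst₂ _≡P_modIB scaled-lhs scaled-rhs (modIB-scaleP c {sumP products +P f₀} eqn)
      where
      scaled-lhs : scaleP c (sumP products +P f₀)
                   ≡ sumP (Vec.toList (Vec.zipWith _*P_ scaled-g P)) +P scaleP c f₀
      scaled-lhs = trans (scaleP-++ c (sumP products) f₀)
        (cong (_+P scaleP c f₀) (sym (sumP-zipWith-map c _*P_ (scaleP c) (scaleP-*P c) g P)))

      scaled-rhs : scaleP c (constP (- fromℕ M)) ≡ constP (- 1ℚ)
      scaled-rhs = cong constP (trans (sym (neg-distribʳ-* c (fromℕ M))) (cong -_ c*M≡1))

    semantic : SemanticSARefutation P
    semantic = record
      { g     = scaled-g
      ; f₀    = scaleP c f₀
      ; f₀-ok = SAConeTerm-scaleP 0≤c f₀-ok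
      ; eqn   = scaled-eqn
      }

    summands-semantic : SemanticSARefutation.summands semantic ≡ List.map (scaleP c) summands
    summands-semantic = begin
      Vec.toList (Vec.zipWith _*P_ scaled-g P) ∷ʳ scaleP c f₀
        ≡⟨ cong (_∷ʳ scaleP c f₀)
                (toList-zipWith-map _*P_ (scaleP c) (scaleP c) (scaleP-*P c) g P) ⟩
      List.map (scaleP c) products ∷ʳ scaleP c f₀
        ≡⟨ List.map-++ (scaleP c) products (f₀ ∷ []) ⟨
      List.map (scaleP c) summands
        ∎
      where open ≡-Reasoning

    coeffSize-semantic : SemanticSARefutation.coeffSize semantic ≡ c * unaryCoeffSize π
    coeffSize-semantic = begin
        sumℚ (List.map coeffSizeP (SemanticSARefutation.summands semantic))
      ≡⟨ cong (sumℚ ∘ List.map coeffSizeP) summands-semantic ⟩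
        sumℚ (List.map coeffSizeP (List.map (scaleP c) summands))
      ≡⟨ cong sumℚ (List.map-∘ summands) ⟨
        sumℚ (List.map (coeffSizeP ∘ scaleP c) summands)
      ≡⟨ cong sumℚ (List.map-cong coeffSizeP-scaleP-nonNeg summands) ⟩
        sumℚ (List.map (λ q → c * coeffSizeP q) summands)
      ≡⟨ sumℚ-map-*ˡ c coeffSizeP summands ⟩
        c * unaryCoeffSize π ∎
      where
      open ≡-Reasoning
      coeffSizeP-scaleP-nonNeg : ∀ q → coeffSizeP (scaleP c q) ≡ c * coeffSizeP q
      coeffSizeP-scaleP-nonNeg q =
        trans (coeffSizeP-scaleP c q) (cong (_* coeffSizeP q) (0≤p⇒∣p∣≡p 0≤c))

proposition2p3 : ∀ {n m : ℕ} (P : Vec (Poly n) m) (s : ℚ) →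
    (∀ (π : SemanticSARefutation P) → s ≤ SemanticSARefutation.coeffSize π) →
    ∀ (π : UnarySARefutation P) → s ≤ (+ UnarySARefutation.size π) / 1
proposition2p3 P s lower π =
  let c , 0≤c , c≤1 , c*M≡1 = reciprocal≤1 M M-pos
      open DivideUnary π 0≤c c*M≡1
  in begin
    s                                       ≤⟨ lower semantic ⟩
    SemanticSARefutation.coeffSize semantic ≡⟨ coeffSize-semantic ⟩
    c * unaryCoeffSize π
      ≤⟨ *-monoˡ-≤-nonNeg c {{nonNegative 0≤c}} (unaryCoeffSize≤size π) ⟩
    c * fromℕ size
      ≤⟨ *-monoʳ-≤-nonNeg (fromℕ size) {{fromℕ-nonNeg size}} c≤1 ⟩
    1ℚ * fromℕ size                         ≡⟨ *-identityˡ (fromℕ size) ⟩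
    fromℕ size                              ∎
  where
  open UnarySARefutation π
  open ≤-Reasoning
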